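{- Let $\vec U$ be a universe of separations and $\vec t\in\vec U$. Then the function $\mathbf 1_{\vec t}\colon\vec U\to\{0,1\}$ with $\mathbf 1_{\vec t}(\vec s)=0$ if $\vec s\le\vec t$ and $\mathbf 1_{\vec t}(\vec s)=1$ otherwise is submodular.
   Context: A universe of separations is a set $\vec U$ with a partial order $\le$ making it a lattice (supremum $\vee$, infimum $\wedge$) and an order-reversing involution. A function $u\colon\vec U\to\mathbb R$ is submodular if $u(\vec r\vee\vec s)+u(\vec r\wedge\vec s)\le u(\vec r)+u(\vec s)$ for all $\vec r,\vec s\in\vec U$. -}

module Defs where

open import Level using (Level; suc; _⊔_)
open import Relation.Binary.PropositionalEquality using (_≡_)
open import Relation.Binary.Structures using (IsPartialOrder)
open import Relation.Binary.Lattice using (Supremum; Infimum)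
open import Relation.Nullary using (¬_)
open import Data.Nat using (ℕ; _+_) renaming (_≤_ to _≤ℕ_)

record Universe (a ℓ : Level) : Set (suc (a ⊔ ℓ)) where
  infixr 7 _∧_
  infixr 6 _∨_
  infix 4 _≤_
  field
    Carrier        : Set a
    _≤_            : Carrier → Carrier → Set ℓ
    _∨_            : Carrier → Carrier → Carrier
    _∧_            : Carrier → Carrier → Carrier
    _*             : Carrier → Carrier
    isPartialOrder : IsPartialOrder _≡_ _≤_
    supremum       : Supremum _≤_ _∨_
    infimum        : Infimum _≤_ _∧_
    involutive     : ∀ s → (s *) * ≡ s
    order-reversing : ∀ {r s} → r ≤ s → s * ≤ r *

-- Submodularity of a function u : U → ℕ (the values here are 0/1, so ℕ ⊆ ℝ suffices).
Submodular : ∀ {a ℓ} (U : Universe a ℓ) → (Universe.Carrier U → ℕ) → Set a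
Submodular U u = ∀ r s → u (r ∨ s) + u (r ∧ s) ≤ℕ u r + u s
  where open Universe U

IsIndicator : ∀ {a ℓ} (U : Universe a ℓ) → Universe.Carrier U → (Universe.Carrier U → ℕ) → Set (a ⊔ ℓ)
IsIndicator U t u = ∀ s → (s ≤ t → u s ≡ 0) × (¬ (s ≤ t) → u s ≡ 1)
  where open Universe U
        open import Data.Product using (_×_)

module Submission where

open import Data.Nat using (ℕ; _+_; _≤?_; z≤n) renaming (_≤_ to _≤ℕ_)
open import Data.Nat.Properties using (+-mono-≤; +-comm; ≤-reflexive)
open import Data.Product using (proj₁; proj₂)
open import Relation.Binary.PropositionalEquality using (_≡_; sym; subst)
open import Relation.Binary.Structures using (IsPartialOrder)
open import Relation.Nullary using (¬_; yes; no)
open import Relation.Nullary.Decidable using (decidable-stable; ¬¬-excluded-middle)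

open import Defs

-- If r ≤ t then r ∧ s ≤ t, and r ∨ s ≤ t exactly when s ≤ t, so the indicator
-- of r ∨ s is at most that of s while the indicator of r ∧ s vanishes; if r ≰ t
-- then 1_t(r) = 1 bounds 1_t(r ∨ s), and r ∧ s ≤ s gives 1_t(r ∧ s) ≤ 1_t(s).
-- The case split on r ≤ t is classical, which is harmless because every goal
-- is an inequality between naturals and hence stable under double negation.

≤ℕ-by-cases : ∀ {p} (P : Set p) {m n : ℕ} → (P → m ≤ℕ n) → (¬ P → m ≤ℕ n) → m ≤ℕ n
≤ℕ-by-cases P if-P if-¬P = decidable-stable (_ ≤? _) λ m≰n →
  ¬¬-excluded-middle λ { (yes p) → m≰n (if-P p) ; (no ¬p) → m≰n (if-¬P ¬p) }

module Indicator {a ℓ} (U : Universe a ℓ) (t : Universe.Carrier U)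
                 (u : Universe.Carrier U → ℕ) (indicator : IsIndicator U t u) where

  open Universe U
  open IsPartialOrder isPartialOrder using (trans)

  ≤t⇒≡0 : ∀ {x} → x ≤ t → u x ≡ 0
  ≤t⇒≡0 {x} = proj₁ (indicator x)

  ≰t⇒≡1 : ∀ {x} → ¬ x ≤ t → u x ≡ 1
  ≰t⇒≡1 {x} = proj₂ (indicator x)

  ≤1 : ∀ x → u x ≤ℕ 1
  ≤1 x = ≤ℕ-by-cases (x ≤ t)
    (λ x≤t → subst (_≤ℕ 1) (sym (≤t⇒≡0 x≤t)) z≤n)
    (λ x≰t → ≤-reflexive (≰t⇒≡1 x≰t))

  ≰t⇒maximal : ∀ {x} y → ¬ x ≤ t → u y ≤ℕ u x
  ≰t⇒maximal y x≰t = subst (u y ≤ℕ_) (sym (≰t⇒≡1 x≰t)) (≤1 y)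

  ≤t⇒minimal : ∀ {x} y → x ≤ t → u x ≤ℕ u y
  ≤t⇒minimal y x≤t = subst (_≤ℕ u y) (sym (≤t⇒≡0 x≤t)) z≤n

  monotone : ∀ {x y} → x ≤ y → u x ≤ℕ u y
  monotone {x} {y} x≤y = ≤ℕ-by-cases (y ≤ t)
    (λ y≤t → ≤t⇒minimal y (trans x≤y y≤t))
    (≰t⇒maximal x)

  join-≤ : ∀ {r} s → r ≤ t → u (r ∨ s) ≤ℕ u s
  join-≤ {r} s r≤t = ≤ℕ-by-cases (s ≤ t)
    (λ s≤t → ≤t⇒minimal s (proj₂ (proj₂ (supremum r s)) t r≤t s≤t))
    (≰t⇒maximal (r ∨ s))

  submodular : Submodular U u
  submodular r s = ≤ℕ-by-cases (r ≤ t)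
    (λ r≤t → subst (u (r ∨ s) + u (r ∧ s) ≤ℕ_) (+-comm (u s) (u r))
                   (+-mono-≤ (join-≤ s r≤t) (monotone (proj₁ (infimum r s)))))
    (λ r≰t → +-mono-≤ (≰t⇒maximal (r ∨ s) r≰t) (monotone (proj₁ (proj₂ (infimum r s)))))

lemma5p3 : ∀ {a ℓ} (U : Universe a ℓ) (t : Universe.Carrier U) (u : Universe.Carrier U → ℕ) → IsIndicator U t u → Submodular U u
lemma5p3 U t u indicator = Indicator.submodular U t u indicator
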